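{- In an AL-monoid $A$, the following assertions are equivalent: (1) for all $a,b,c\in A$: $(a,b,c)L$ if and only if $(a,b,c)M$; (2) metric betweenness has transitivity $t_1$, i.e. for all $a,b,c,d\in A$, $(a,b,c)M$ and $(a,d,b)M$ imply $(d,b,c)M$; (3) for all $a,b,c\in A$: $a\geq b\vee c$ and $a\ast b\geq a\ast c$ imply $b\leq c$; (4) for all $a,b,c\in A$: $(a,b,c)M$ and $(a,c,b)M$ imply $b=c$.
   Context: An AL-monoid (autometrized lattice ordered monoid) is an algebra $(A,+,\vee,\wedge,\ast,0)$ of type $(2,2,2,2,0)$ such that: (1) $(A,+,\vee,\wedge,0)$ is a commutative lattice ordered monoid, i.e. $(A,+,0)$ is a commutative monoid with identity $0$, $(A,\vee,\wedge)$ is a lattice with induced order $\leq$, and $a+(b\vee c)=(a+b)\vee(a+c)$, $a+(b\wedge c)=(a+b)\wedge(a+c)$; (2) $a\ast(a\wedge b)+b=a\vee b$ for all $a,b$; (3) for each $a\in A$ the maps $x\mapsto a+x$, $x\mapsto a\vee x$, $x\mapsto a\wedge x$, $x\mapsto a\ast x$ are contractions with respect to $\ast$, i.e. $f(x)\ast f(y)\leq x\ast y$ for all $x,y$; (4) $[a\ast(a\vee b)]\wedge[b\ast(a\vee b)]=0$ for all $a,b$; and $\ast$ is a metric operation: $a\ast b\geq 0$ with equality iff $a=b$, $a\ast b=b\ast a$, and $a\ast b\leq a\ast c+c\ast b$ for all $a,b,c$. Lattice betweenness $(a,b,c)L$ means $a\wedge c\leq b\leq a\vee c$; metric betweenness $(a,b,c)M$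 means $a\ast b+b\ast c=a\ast c$. -}

module Defs where

open import Level using (Level; suc; _⊔_)
open import Data.Product using (_×_)
open import Relation.Binary.PropositionalEquality using (_≡_)

-- An AL-monoid (autometrized lattice ordered monoid), with propositional
-- equality on the carrier.  The lattice order is  a ≤ b  :⇔  a ∧ b ≡ a.
record ALMonoid (c : Level) : Set (suc c) where
  infixl 6 _+_
  infixr 7 _∨_
  infixr 8 _∧_
  infix 9 _✶_
  infix 4 _≤_
  field
    Carrier : Set c
    _+_ _∨_ _∧_ _✶_ : Carrier → Carrier → Carrier
    𝟘 : Carrier

  _≤_ : Carrier → Carrier → Set c
  a ≤ b = a ∧ b ≡ a

  field
    +-assoc    : ∀ a b c → (a + b) + c ≡ a + (b + c)
    +-comm     : ∀ a b → a + b ≡ b + a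
    +-identityˡ : ∀ a → 𝟘 + a ≡ a
    ∨-assoc : ∀ a b c → (a ∨ b) ∨ c ≡ a ∨ (b ∨ c)
    ∨-comm  : ∀ a b → a ∨ b ≡ b ∨ a
    ∧-assoc : ∀ a b c → (a ∧ b) ∧ c ≡ a ∧ (b ∧ c)
    ∧-comm  : ∀ a b → a ∧ b ≡ b ∧ a
    ∨-absorbs-∧ : ∀ a b → a ∨ (a ∧ b) ≡ a
    ∧-absorbs-∨ : ∀ a b → a ∧ (a ∨ b) ≡ a
    +-distrib-∨ : ∀ a b c → a + (b ∨ c) ≡ (a + b) ∨ (a + c)
    +-distrib-∧ : ∀ a b c → a + (b ∧ c) ≡ (a + b) ∧ (a + c)
    ax2 : ∀ a b → a ✶ (a ∧ b) + b ≡ a ∨ b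
    contr-+ : ∀ a x y → (a + x) ✶ (a + y) ≤ x ✶ y
    contr-∨ : ∀ a x y → (a ∨ x) ✶ (a ∨ y) ≤ x ✶ y
    contr-∧ : ∀ a x y → (a ∧ x) ✶ (a ∧ y) ≤ x ✶ y
    contr-✶ : ∀ a x y → (a ✶ x) ✶ (a ✶ y) ≤ x ✶ y
    ax4 : ∀ a b → (a ✶ (a ∨ b)) ∧ (b ✶ (a ∨ b)) ≡ 𝟘
    ✶-nonneg : ∀ a b → 𝟘 ≤ a ✶ b
    ✶-zero⇒≡ : ∀ a b → a ✶ b ≡ 𝟘 → a ≡ b
    ✶-self   : ∀ a → a ✶ a ≡ 𝟘
    ✶-comm   : ∀ a b → a ✶ b ≡ b ✶ a
    ✶-triangle : ∀ a b c → a ✶ b ≤ a ✶ c + c ✶ b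

  BetL : Carrier → Carrier → Carrier → Set c
  BetL a b c = (a ∧ c ≤ b) × (b ≤ a ∨ c)

  BetM : Carrier → Carrier → Carrier → Set c
  BetM a b c = a ✶ b + b ✶ c ≡ a ✶ c

  Cond1 : Set c
  Cond1 = ∀ a b c → (BetL a b c → BetM a b c) × (BetM a b c → BetL a b c)

  Cond2 : Set c
  Cond2 = ∀ a b c d → BetM a b c → BetM a d b → BetM d b c

  Cond3 : Set c
  Cond3 = ∀ a b c → b ∨ c ≤ a → a ✶ c ≤ a ✶ b → b ≤ c

  Cond4 : Set c
  Cond4 = ∀ a b c → BetM a b c → BetM a c b → b ≡ c

-- Axiom (4) makes the lattice distributive, and with that lattice betweenness
-- implies metric betweenness.  Conversely (a, b, c)M always gives b ≤ a ∨ c: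
-- going from b through b ∧ (a ∨ c) is a metric detour whose length is absorbed
-- by a ✶ c.  The dual detour through b ∨ (a ∧ c) only yields
-- (a ∨ c) ✶ (b ∧ (a ∧ c)) ≡ (a ∨ c) ✶ (a ∧ c), and (3) is exactly what turns
-- this into a ∧ c ≤ b; so (3) ⇒ (1).  Of the other steps only (4) ⇒ (3) has
-- content: under the hypotheses of (3), b ✶ (b ∧ c) is absorbed by a ✶ b, so b
-- and b ∧ c both lie metrically between a and b ∧ c.
module Submission where

open import Algebra.Bundles using (CommutativeSemigroup)
open import Algebra.Lattice.Bundles using (Lattice)
import Algebra.Lattice.Properties.Lattice as LatticeProperties
import Algebra.Properties.CommutativeSemigroup as CommutativeSemigroupProperties
open import Data.Product using (_×_; _,_; proj₁; proj₂)
open import Level using (Level)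
import Relation.Binary.Lattice as OrderTheoretic
import Relation.Binary.Lattice.Properties.JoinSemilattice as JoinSemilatticeProperties
import Relation.Binary.Lattice.Properties.MeetSemilattice as MeetSemilatticeProperties
open import Relation.Binary.PropositionalEquality

open import Defs

module ALMonoidProperties {ℓ : Level} (A : ALMonoid ℓ) where
  open ALMonoid A
  open ≡-Reasoning

  ∨-∧-lattice : Lattice ℓ ℓ
  ∨-∧-lattice = record
    { isLattice = record
      { isEquivalence = isEquivalence
      ; ∨-comm        = ∨-comm
      ; ∨-assoc       = ∨-assoc
      ; ∨-cong        = cong₂ _∨_
      ; ∧-comm        = ∧-comm
      ; ∧-assoc       = ∧-assoc
      ; ∧-cong        = cong₂ _∧_
      ; absorptive    = ∨-absorbs-∧ , ∧-absorbs-∨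
      }
    }

  open LatticeProperties ∨-∧-lattice using (∧-idem; ∨-∧-orderTheoreticLattice)
  private
    module O = OrderTheoretic.Lattice ∨-∧-orderTheoreticLattice
    module J = JoinSemilatticeProperties O.joinSemilattice
    module M = MeetSemilatticeProperties O.meetSemilattice

  -- The library orders a lattice by a ≡ a ∧ b, the record by a ∧ b ≡ a, so
  -- the order-theoretic lemmas below are the library's ones up to sym.
  ≤-refl : ∀ {a} → a ≤ a
  ≤-refl = ∧-idem _

  ≤-reflexive : ∀ {a b} → a ≡ b → a ≤ b
  ≤-reflexive refl = ≤-refl

  ≤-trans : ∀ {a b c} → a ≤ b → b ≤ c → a ≤ c
  ≤-trans p q = sym (O.trans (sym p) (sym q))

  ≤-antisym : ∀ {a b} → a ≤ b → b ≤ a → a ≡ b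
  ≤-antisym p q = O.antisym (sym p) (sym q)

  x∧y≤x : ∀ a b → a ∧ b ≤ a
  x∧y≤x a b = sym (O.x∧y≤x a b)

  x∧y≤y : ∀ a b → a ∧ b ≤ b
  x∧y≤y a b = sym (O.x∧y≤y a b)

  x≤x∨y : ∀ a b → a ≤ a ∨ b
  x≤x∨y a b = sym (O.x≤x∨y a b)

  y≤x∨y : ∀ a b → b ≤ a ∨ b
  y≤x∨y a b = sym (O.y≤x∨y a b)

  ∧-greatest : ∀ {a b c} → a ≤ b → a ≤ c → a ≤ b ∧ c
  ∧-greatest p q = sym (O.∧-greatest (sym p) (sym q))

  ∨-least : ∀ {a b c} → a ≤ c → b ≤ c → a ∨ b ≤ c
  ∨-least p q = sym (O.∨-least (sym p) (sym q))

  ∧-monotonic : ∀ {a a′ b b′} → a ≤ a′ → b ≤ b′ → a ∧ b ≤ a′ ∧ b′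
  ∧-monotonic p q = sym (M.∧-monotonic (sym p) (sym q))

  ∨-monotonic : ∀ {a a′ b b′} → a ≤ a′ → b ≤ b′ → a ∨ b ≤ a′ ∨ b′
  ∨-monotonic p q = sym (J.∨-monotonic (sym p) (sym q))

  x≤y⇒x∨y≡y : ∀ {a b} → a ≤ b → a ∨ b ≡ b
  x≤y⇒x∨y≡y {a} {b} p = ≤-antisym (∨-least p ≤-refl) (y≤x∨y a b)

  x≤y⇒y∧x≡x : ∀ {a b} → a ≤ b → b ∧ a ≡ a
  x≤y⇒y∧x≡x {a} {b} p = trans (∧-comm b a) p

  +-commutativeSemigroup : CommutativeSemigroup ℓ ℓ
  +-commutativeSemigroup = record
    { _∙_ = _+_
    ; isCommutativeSemigroup = record
      { isSemigroup = record
        { isMagma = record { isEquivalence = isEquivalence ; ∙-cong = cong₂ _+_ }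
        ; assoc   = +-assoc
        }
      ; comm = +-comm
      }
    }

  open CommutativeSemigroupProperties +-commutativeSemigroup using (interchange; xy∙z≈xz∙y)

  +-identityʳ : ∀ a → a + 𝟘 ≡ a
  +-identityʳ a = trans (+-comm a 𝟘) (+-identityˡ a)

  +-monoʳ-≤ : ∀ {a b} c → a ≤ b → c + a ≤ c + b
  +-monoʳ-≤ {a} {b} c p = trans (sym (+-distrib-∧ c a b)) (cong (c +_) p)

  +-monoˡ-≤ : ∀ {a b} c → a ≤ b → a + c ≤ b + c
  +-monoˡ-≤ {a} {b} c p = subst₂ _≤_ (+-comm c a) (+-comm c b) (+-monoʳ-≤ c p)

  +-mono-≤ : ∀ {a a′ b b′} → a ≤ a′ → b ≤ b′ → a + b ≤ a′ + b′
  +-mono-≤ {a′ = a′} {b = b} p q = ≤-trans (+-monoˡ-≤ b p) (+-monoʳ-≤ a′ q)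

  x≤x+y : ∀ {a b} → 𝟘 ≤ b → a ≤ a + b
  x≤x+y {a} {b} p = subst (_≤ a + b) (+-identityʳ a) (+-monoʳ-≤ a p)

  x≤y+x : ∀ {a b} → 𝟘 ≤ b → a ≤ b + a
  x≤y+x {a} {b} p = subst (_≤ b + a) (+-identityˡ a) (+-monoˡ-≤ a p)

  disjoint⇒+≤∨ : ∀ {a b} → a ∧ b ≡ 𝟘 → a + b ≤ a ∨ b
  disjoint⇒+≤∨ {a} {b} a∧b≡𝟘 = subst (a + b ≤_) ∨-+-∧≡∨ (∧-greatest ≤∨+a ≤∨+b)
    where
    ≤∨+a : a + b ≤ (a ∨ b) + a
    ≤∨+a = subst (_≤ (a ∨ b) + a) (+-comm b a) (+-monoˡ-≤ a (y≤x∨y a b))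
    ≤∨+b : a + b ≤ (a ∨ b) + b
    ≤∨+b = +-monoˡ-≤ b (x≤x∨y a b)
    ∨-+-∧≡∨ : ((a ∨ b) + a) ∧ ((a ∨ b) + b) ≡ a ∨ b
    ∨-+-∧≡∨ = begin
      ((a ∨ b) + a) ∧ ((a ∨ b) + b) ≡⟨ +-distrib-∧ (a ∨ b) a b ⟨
      (a ∨ b) + a ∧ b               ≡⟨ cong ((a ∨ b) +_) a∧b≡𝟘 ⟩
      (a ∨ b) + 𝟘                   ≡⟨ +-identityʳ (a ∨ b) ⟩
      a ∨ b                         ∎

  x✶y+y≡x : ∀ {a b} → b ≤ a → a ✶ b + b ≡ a
  x✶y+y≡x {a} {b} b≤a = begin
    a ✶ b + b        ≡⟨ cong (λ t → a ✶ t + b) (x≤y⇒y∧x≡x b≤a) ⟨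
    a ✶ (a ∧ b) + b  ≡⟨ ax2 a b ⟩
    a ∨ b            ≡⟨ ∨-comm a b ⟩
    b ∨ a            ≡⟨ x≤y⇒x∨y≡y b≤a ⟩
    a                ∎

  x✶𝟘≡x : ∀ {a} → 𝟘 ≤ a → a ✶ 𝟘 ≡ a
  x✶𝟘≡x {a} 𝟘≤a = trans (sym (+-identityʳ (a ✶ 𝟘))) (x✶y+y≡x 𝟘≤a)

  x≤t+y⇒x✶y≤t : ∀ {a b t} → b ≤ a → a ≤ t + b → 𝟘 ≤ t → a ✶ b ≤ t
  x≤t+y⇒x✶y≤t {a} {b} {t} b≤a a≤t+b 𝟘≤t = ≤-trans a✶b≤t+b✶b t+b✶b≤t
    where
    a✶b≤t+b✶b : a ✶ b ≤ (t + b) ✶ b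
    a✶b≤t+b✶b = subst₂ (λ u v → u ✶ v ≤ (t + b) ✶ b) a≤t+b (x≤y⇒y∧x≡x b≤a)
                  (contr-∧ a (t + b) b)
    t+b✶b≤t : (t + b) ✶ b ≤ t
    t+b✶b≤t = subst₂ _≤_ (cong₂ _✶_ (+-comm b t) (+-identityʳ b)) (x✶𝟘≡x 𝟘≤t)
                (contr-+ b t 𝟘)

  BetM-sym : ∀ {a b c} → BetM a b c → BetM c b a
  BetM-sym {a} {b} {c} abc = begin
    c ✶ b + b ✶ a  ≡⟨ +-comm (c ✶ b) (b ✶ a) ⟩
    b ✶ a + c ✶ b  ≡⟨ cong₂ _+_ (✶-comm b a) (✶-comm c b) ⟩
    a ✶ b + b ✶ c  ≡⟨ abc ⟩
    a ✶ c          ≡⟨ ✶-comm a c ⟩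
    c ✶ a          ∎

  BetM⇒✶≤ˡ : ∀ {a b c} → BetM a b c → a ✶ b ≤ a ✶ c
  BetM⇒✶≤ˡ {a} {b} {c} abc = subst (a ✶ b ≤_) abc (x≤x+y (✶-nonneg b c))

  BetM⇒✶≤ʳ : ∀ {a b c} → BetM a b c → b ✶ c ≤ a ✶ c
  BetM⇒✶≤ʳ {a} {b} {c} abc = subst (b ✶ c ≤_) abc (x≤y+x (✶-nonneg a b))

  -- (a ✶ c) ✶ (b ✶ c) bounds a ✶ b, because adding it to b gives back a.
  chain⇒BetM : ∀ {a b c} → c ≤ b → b ≤ a → BetM a b c
  chain⇒BetM {a} {b} {c} c≤b b≤a = ≤-antisym a✶b+b✶c≤a✶c (✶-triangle a c b)
    where
    w = a ✶ c
    v = b ✶ c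
    c≤a : c ≤ a
    c≤a = ≤-trans c≤b b≤a
    v≤w : v ≤ w
    v≤w = x≤t+y⇒x✶y≤t c≤b (subst (b ≤_) (sym (x✶y+y≡x c≤a)) b≤a) (✶-nonneg a c)
    a≡w✶v+b : a ≡ w ✶ v + b
    a≡w✶v+b = begin
      a                ≡⟨ x✶y+y≡x c≤a ⟨
      w + c            ≡⟨ cong (_+ c) (x✶y+y≡x v≤w) ⟨
      (w ✶ v + v) + c  ≡⟨ +-assoc (w ✶ v) v c ⟩
      w ✶ v + (v + c)  ≡⟨ cong (w ✶ v +_) (x✶y+y≡x c≤b) ⟩
      w ✶ v + b        ∎
    a✶b≤w✶v : a ✶ b ≤ w ✶ v
    a✶b≤w✶v = x≤t+y⇒x✶y≤t b≤a (≤-reflexive a≡w✶v+b) (✶-nonneg w v)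
    a✶b+b✶c≤a✶c : a ✶ b + v ≤ w
    a✶b+b✶c≤a✶c = subst (a ✶ b + v ≤_) (x✶y+y≡x v≤w) (+-monoˡ-≤ v a✶b≤w✶v)

  x✶x∧y≡x∨y✶y : ∀ a b → a ✶ (a ∧ b) ≡ (a ∨ b) ✶ b
  x✶x∧y≡x∨y✶y a b = ≤-antisym
    (subst (λ u → u ✶ (a ∧ b) ≤ (a ∨ b) ✶ b) (∧-absorbs-∨ a b) (contr-∧ a (a ∨ b) b))
    (subst₂ (λ u v → u ✶ v ≤ a ✶ (a ∧ b)) (∨-comm b a) b∨a∧b≡b (contr-∨ b a (a ∧ b)))
    where
    b∨a∧b≡b : b ∨ (a ∧ b) ≡ b
    b∨a∧b≡b = trans (cong (b ∨_) (∧-comm a b)) (∨-absorbs-∧ b a)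

  x∨y✶x≡y✶x∧y : ∀ a b → (a ∨ b) ✶ a ≡ b ✶ (a ∧ b)
  x∨y✶x≡y✶x∧y a b = begin
    (a ∨ b) ✶ a  ≡⟨ cong (_✶ a) (∨-comm a b) ⟩
    (b ∨ a) ✶ a  ≡⟨ x✶x∧y≡x∨y✶y b a ⟨
    b ✶ (b ∧ a)  ≡⟨ cong (b ✶_) (∧-comm b a) ⟩
    b ✶ (a ∧ b)  ∎

  ∨-✶-disjoint : ∀ a b → ((a ∨ b) ✶ a) ∧ ((a ∨ b) ✶ b) ≡ 𝟘
  ∨-✶-disjoint a b = trans (cong₂ _∧_ (✶-comm (a ∨ b) a) (✶-comm (a ∨ b) b)) (ax4 a b)

  ✶-∧-disjoint : ∀ a b → (a ✶ (a ∧ b)) ∧ (b ✶ (a ∧ b)) ≡ 𝟘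
  ✶-∧-disjoint a b = begin
    (a ✶ (a ∧ b)) ∧ (b ✶ (a ∧ b))  ≡⟨ cong₂ _∧_ (x✶x∧y≡x∨y✶y a b) (sym (x∨y✶x≡y✶x∧y a b)) ⟩
    ((a ∨ b) ✶ b) ∧ ((a ∨ b) ✶ a)  ≡⟨ ∧-comm _ _ ⟩
    ((a ∨ b) ✶ a) ∧ ((a ∨ b) ✶ b)  ≡⟨ ∨-✶-disjoint a b ⟩
    𝟘                              ∎

  -- The two legs are disjoint, so their sum is their join.
  BetM-∧ : ∀ a b → BetM a (a ∧ b) b
  BetM-∧ a b = ≤-antisym legs≤a✶b (✶-triangle a b (a ∧ b))
    where
    a✶a∧b≤a✶b : a ✶ (a ∧ b) ≤ a ✶ b
    a✶a∧b≤a✶b = subst (λ u → u ✶ (a ∧ b) ≤ a ✶ b) (∧-idem a) (contr-∧ a a b)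
    b✶a∧b≤a✶b : b ✶ (a ∧ b) ≤ a ✶ b
    b✶a∧b≤a✶b = subst (_≤ a ✶ b) (trans (cong₂ _✶_ (∧-comm b a) (∧-idem b)) (✶-comm (a ∧ b) b))
                  (contr-∧ b a b)
    legs≤a✶b : a ✶ (a ∧ b) + (a ∧ b) ✶ b ≤ a ✶ b
    legs≤a✶b = subst (λ t → a ✶ (a ∧ b) + t ≤ a ✶ b) (✶-comm b (a ∧ b))
      (≤-trans (disjoint⇒+≤∨ (✶-∧-disjoint a b)) (∨-least a✶a∧b≤a✶b b✶a∧b≤a✶b))

  ✶≡∨✶∧ : ∀ a b → a ✶ b ≡ (a ∨ b) ✶ (a ∧ b)
  ✶≡∨✶∧ a b = begin
    a ✶ b                      ≡⟨ BetM-∧ a b ⟨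
    a ✶ (a ∧ b) + (a ∧ b) ✶ b  ≡⟨ +-comm _ _ ⟩
    (a ∧ b) ✶ b + a ✶ (a ∧ b)  ≡⟨ cong (_+ a ✶ (a ∧ b)) a∧b✶b≡a∨b✶a ⟩
    (a ∨ b) ✶ a + a ✶ (a ∧ b)  ≡⟨ chain⇒BetM (x∧y≤x a b) (x≤x∨y a b) ⟩
    (a ∨ b) ✶ (a ∧ b)          ∎
    where
    a∧b✶b≡a∨b✶a : (a ∧ b) ✶ b ≡ (a ∨ b) ✶ a
    a∧b✶b≡a∨b✶a = trans (✶-comm (a ∧ b) b) (sym (x∨y✶x≡y✶x∧y a b))

  -- This is distributivity of the lattice, obtained from the metric:
  -- x ✶ ((p ∧ x) ∨ (q ∧ x)) lies below both (p ∨ q) ✶ p and (p ∨ q) ✶ q,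
  -- which are disjoint by axiom (4).
  ≤∨⇒≤∧∨∧ : ∀ {x p q} → x ≤ p ∨ q → x ≤ (p ∧ x) ∨ (q ∧ x)
  ≤∨⇒≤∧∨∧ {x} {p} {q} x≤p∨q =
    ≤-reflexive (✶-zero⇒≡ x y (≤-antisym x✶y≤𝟘 (✶-nonneg x y)))
    where
    y = (p ∧ x) ∨ (q ∧ x)
    y≤x : y ≤ x
    y≤x = ∨-least (x∧y≤y p x) (x∧y≤y q x)
    x✶y≤p∨q✶r : ∀ r → r ≤ p ∨ q → r ∧ x ≤ y → x ✶ y ≤ (p ∨ q) ✶ r
    x✶y≤p∨q✶r r r≤p∨q r∧x≤y = ≤-trans (BetM⇒✶≤ˡ (chain⇒BetM r∧x≤y y≤x)) x✶r∧x≤p∨q✶r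
      where
      x✶r∧x≡x∨r✶r : x ✶ (r ∧ x) ≡ (x ∨ r) ✶ r
      x✶r∧x≡x∨r✶r = trans (cong (x ✶_) (∧-comm r x)) (x✶x∧y≡x∨y✶y x r)
      x✶r∧x≤p∨q✶r : x ✶ (r ∧ x) ≤ (p ∨ q) ✶ r
      x✶r∧x≤p∨q✶r = subst (_≤ (p ∨ q) ✶ r) (sym x✶r∧x≡x∨r✶r)
        (BetM⇒✶≤ʳ (chain⇒BetM (y≤x∨y x r) (∨-least x≤p∨q r≤p∨q)))
    x✶y≤𝟘 : x ✶ y ≤ 𝟘
    x✶y≤𝟘 = subst (x ✶ y ≤_) (∨-✶-disjoint p q) (∧-greatest
      (x✶y≤p∨q✶r p (x≤x∨y p q) (x≤x∨y (p ∧ x) (q ∧ x)))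
      (x✶y≤p∨q✶r q (y≤x∨y p q) (y≤x∨y (p ∧ x) (q ∧ x))))

  -- b splits as P ∨ Q with P ∧ Q = a ∧ c, and the distances through b then
  -- recombine into the two legs of BetM a (a ∧ c) c.
  BetL⇒BetM : ∀ a b c → BetL a b c → BetM a b c
  BetL⇒BetM a b c (a∧c≤b , b≤a∨c) = begin
    a ✶ b + b ✶ c
      ≡⟨ cong₂ _+_ (BetM-∧ a b) (BetM-sym (BetM-∧ c b)) ⟨
    (a ✶ P + P ✶ b) + (b ✶ Q + Q ✶ c)
      ≡⟨ cong₂ (λ u v → (a ✶ P + u) + (v + Q ✶ c)) P✶b≡m✶Q b✶Q≡P✶m ⟩
    (a ✶ P + m ✶ Q) + (P ✶ m + Q ✶ c)
      ≡⟨ interchange (a ✶ P) (m ✶ Q) (P ✶ m) (Q ✶ c) ⟩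
    (a ✶ P + P ✶ m) + (m ✶ Q + Q ✶ c)
      ≡⟨ cong₂ _+_ (chain⇒BetM m≤P (x∧y≤x a b)) (BetM-sym (chain⇒BetM m≤Q (x∧y≤x c b))) ⟩
    a ✶ m + m ✶ c
      ≡⟨ BetM-∧ a c ⟩
    a ✶ c
      ∎
    where
    P = a ∧ b
    Q = c ∧ b
    m = a ∧ c
    m≤P : m ≤ P
    m≤P = ∧-greatest (x∧y≤x a c) a∧c≤b
    m≤Q : m ≤ Q
    m≤Q = ∧-greatest (x∧y≤y a c) a∧c≤b
    b≡P∨Q : b ≡ P ∨ Q
    b≡P∨Q = ≤-antisym (≤∨⇒≤∧∨∧ b≤a∨c) (∨-least (x∧y≤y a b) (x∧y≤y c b))
    P∧Q≡m : P ∧ Q ≡ m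
    P∧Q≡m = ≤-antisym (∧-monotonic (x∧y≤x a b) (x∧y≤x c b)) (∧-greatest m≤P m≤Q)
    P✶b≡m✶Q : P ✶ b ≡ m ✶ Q
    P✶b≡m✶Q = begin
      P ✶ b        ≡⟨ ✶-comm P b ⟩
      b ✶ P        ≡⟨ cong (_✶ P) b≡P∨Q ⟩
      (P ∨ Q) ✶ P  ≡⟨ x∨y✶x≡y✶x∧y P Q ⟩
      Q ✶ (P ∧ Q)  ≡⟨ cong (Q ✶_) P∧Q≡m ⟩
      Q ✶ m        ≡⟨ ✶-comm Q m ⟩
      m ✶ Q        ∎
    b✶Q≡P✶m : b ✶ Q ≡ P ✶ m
    b✶Q≡P✶m = begin
      b ✶ Q        ≡⟨ cong (_✶ Q) b≡P∨Q ⟩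
      (P ∨ Q) ✶ Q  ≡⟨ x✶x∧y≡x∨y✶y P Q ⟨
      P ✶ (P ∧ Q)  ≡⟨ cong (P ✶_) P∧Q≡m ⟩
      P ✶ m        ∎

  -- By the triangle inequality a ✶ c = a ✶ x + x ✶ c, while going through b
  -- shows that a ✶ c is that sum plus b ✶ x twice.
  BetM-detour : ∀ {a b c x} → BetM a b c → BetM a x b → BetM b x c → a ✶ c + b ✶ x ≡ a ✶ c
  BetM-detour {a} {b} {c} {x} abc axb bxc =
    ≤-antisym (subst (a ✶ c + e ≤_) a✶c+2e≡a✶c (+-monoʳ-≤ (a ✶ c) (x≤x+y (✶-nonneg b x))))
              (x≤x+y (✶-nonneg b x))
    where
    e = b ✶ x
    a✶c≡a✶x+x✶c : a ✶ c ≡ a ✶ x + x ✶ c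
    a✶c≡a✶x+x✶c = ≤-antisym (✶-triangle a c x)
      (≤-trans (+-mono-≤ (BetM⇒✶≤ˡ axb) (BetM⇒✶≤ʳ bxc)) (≤-reflexive abc))
    a✶c+2e≡a✶c : a ✶ c + (e + e) ≡ a ✶ c
    a✶c+2e≡a✶c = begin
      a ✶ c + (e + e)                  ≡⟨ cong (_+ (e + e)) a✶c≡a✶x+x✶c ⟩
      (a ✶ x + x ✶ c) + (e + e)        ≡⟨ interchange (a ✶ x) (x ✶ c) e e ⟩
      (a ✶ x + e) + (x ✶ c + e)        ≡⟨ cong₂ _+_ (cong (a ✶ x +_) (✶-comm b x)) (+-comm (x ✶ c) e) ⟩
      (a ✶ x + x ✶ b) + (b ✶ x + x ✶ c)  ≡⟨ cong₂ _+_ axb bxc ⟩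
      a ✶ b + b ✶ c                    ≡⟨ abc ⟩
      a ✶ c                            ∎

  BetM⇒≤∨ : ∀ {a b c} → BetM a b c → b ≤ a ∨ c
  BetM⇒≤∨ {a} {b} {c} abc = subst (b ≤_) b∨j≡j (x≤x∨y b j)
    where
    j = a ∨ c
    m = a ∧ c
    x = b ∧ j
    m≤j : m ≤ j
    m≤j = ≤-trans (x∧y≤x a c) (x≤x∨y a c)
    axb : BetM a x b
    axb = BetL⇒BetM a x b
      (∧-greatest (x∧y≤y a b) (≤-trans (x∧y≤x a b) (x≤x∨y a c)) , ≤-trans (x∧y≤x b j) (y≤x∨y a b))
    bxc : BetM b x c
    bxc = BetL⇒BetM b x c
      (∧-greatest (x∧y≤x b c) (≤-trans (x∧y≤y b c) (y≤x∨y a c)) , ≤-trans (x∧y≤x b j) (x≤x∨y b c))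
    b∨j≡j : b ∨ j ≡ j
    b∨j≡j = begin
      b ∨ j                ≡⟨ x✶y+y≡x (y≤x∨y b j) ⟨
      (b ∨ j) ✶ j + j      ≡⟨ cong (_+ j) (x✶x∧y≡x∨y✶y b j) ⟨
      b ✶ x + j            ≡⟨ cong (b ✶ x +_) (x✶y+y≡x m≤j) ⟨
      b ✶ x + (j ✶ m + m)  ≡⟨ cong (λ t → b ✶ x + (t + m)) (✶≡∨✶∧ a c) ⟨
      b ✶ x + (a ✶ c + m)  ≡⟨ +-assoc (b ✶ x) (a ✶ c) m ⟨
      (b ✶ x + a ✶ c) + m  ≡⟨ cong (_+ m) (trans (+-comm (b ✶ x) (a ✶ c)) (BetM-detour abc axb bxc)) ⟩
      a ✶ c + m            ≡⟨ cong (_+ m) (✶≡∨✶∧ a c) ⟩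
      j ✶ m + m            ≡⟨ x✶y+y≡x m≤j ⟩
      j                    ∎

  Cond3⇒BetM⇒∧≤ : Cond3 → ∀ {a b c} → BetM a b c → a ∧ c ≤ b
  Cond3⇒BetM⇒∧≤ cond3 {a} {b} {c} abc =
    ≤-trans (cond3 j m m′ (∨-least m≤j (≤-trans (x∧y≤y b m) m≤j)) (≤-reflexive j✶m′≡j✶m))
            (x∧y≤x b m)
    where
    j = a ∨ c
    m = a ∧ c
    x = b ∨ m
    m′ = b ∧ m
    m≤j : m ≤ j
    m≤j = ≤-trans (x∧y≤x a c) (x≤x∨y a c)
    axb : BetM a x b
    axb = BetL⇒BetM a x b
      (≤-trans (x∧y≤y a b) (x≤x∨y b m) , ∨-least (y≤x∨y a b) (≤-trans (x∧y≤x a c) (x≤x∨y a b)))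
    bxc : BetM b x c
    bxc = BetL⇒BetM b x c
      (≤-trans (x∧y≤x b c) (x≤x∨y b m) , ∨-least (x≤x∨y b c) (≤-trans (x∧y≤y a c) (y≤x∨y b c)))
    j✶m′≡j✶m : j ✶ m′ ≡ j ✶ m
    j✶m′≡j✶m = begin
      j ✶ m′          ≡⟨ chain⇒BetM (x∧y≤y b m) m≤j ⟨
      j ✶ m + m ✶ m′  ≡⟨ cong₂ _+_ (✶≡∨✶∧ a c) (trans (✶-comm b x) (x∨y✶x≡y✶x∧y b m)) ⟨
      a ✶ c + b ✶ x   ≡⟨ BetM-detour abc axb bxc ⟩
      a ✶ c           ≡⟨ ✶≡∨✶∧ a c ⟩
      j ✶ m           ∎

  Cond3⇒Cond1 : Cond3 → Cond1
  Cond3⇒Cond1 cond3 a b c = BetL⇒BetM a b c , λ abc → Cond3⇒BetM⇒∧≤ cond3 abc , BetM⇒≤∨ abc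

  Cond1⇒Cond2 : Cond1 → Cond2
  Cond1⇒Cond2 cond1 a b c d abc adb = proj₁ (cond1 d b c) (d∧c≤b , b≤d∨c)
    where
    a∧c≤b : a ∧ c ≤ b
    a∧c≤b = proj₁ (proj₂ (cond1 a b c) abc)
    b≤a∨c : b ≤ a ∨ c
    b≤a∨c = proj₂ (proj₂ (cond1 a b c) abc)
    a∧b≤d : a ∧ b ≤ d
    a∧b≤d = proj₁ (proj₂ (cond1 a d b) adb)
    d≤a∨b : d ≤ a ∨ b
    d≤a∨b = proj₂ (proj₂ (cond1 a d b) adb)
    b≤d∨c : b ≤ d ∨ c
    b≤d∨c = ≤-trans (≤∨⇒≤∧∨∧ b≤a∨c) (∨-monotonic a∧b≤d (x∧y≤x c b))
    z = (a ∨ b) ∧ c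
    z≤b : z ≤ b
    z≤b = ≤-trans (≤∨⇒≤∧∨∧ (x∧y≤x (a ∨ b) c))
      (∨-least (≤-trans (∧-monotonic ≤-refl (x∧y≤y (a ∨ b) c)) a∧c≤b) (x∧y≤x b z))
    d∧c≤b : d ∧ c ≤ b
    d∧c≤b = ≤-trans (∧-monotonic d≤a∨b ≤-refl) z≤b

  Cond2⇒Cond4 : Cond2 → Cond4
  Cond2⇒Cond4 cond2 a b c abc acb = ✶-zero⇒≡ b c (≤-antisym b✶c≤𝟘 (✶-nonneg b c))
    where
    b✶c≤𝟘 : b ✶ c ≤ 𝟘
    b✶c≤𝟘 = subst (b ✶ c ≤_) (trans (cond2 a b c c abc acb) (✶-self c)) (x≤y+x (✶-nonneg c b))

  Cond4⇒Cond3 : Cond4 → Cond3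
  Cond4⇒Cond3 cond4 a b c b∨c≤a a✶c≤a✶b =
    subst (_≤ c) (sym (cond4 a b e abe aeb)) (x∧y≤y b c)
    where
    e = b ∧ c
    u = b ∨ c
    w = a ✶ u
    s = b ✶ e
    r = c ✶ e
    a✶c≡w+s : a ✶ c ≡ w + s
    a✶c≡w+s = trans (sym (chain⇒BetM (y≤x∨y b c) b∨c≤a)) (cong (w +_) (sym (x✶x∧y≡x∨y✶y b c)))
    a✶b≡w+r : a ✶ b ≡ w + r
    a✶b≡w+r = trans (sym (chain⇒BetM (x≤x∨y b c) b∨c≤a)) (cong (w +_) (x∨y✶x≡y✶x∧y b c))
    w+s≡w : w + s ≡ w
    w+s≡w = begin
      w + s              ≡⟨ subst₂ _≤_ a✶c≡w+s a✶b≡w+r a✶c≤a✶b ⟨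
      (w + s) ∧ (w + r)  ≡⟨ +-distrib-∧ w s r ⟨
      w + s ∧ r          ≡⟨ cong (w +_) (✶-∧-disjoint b c) ⟩
      w + 𝟘              ≡⟨ +-identityʳ w ⟩
      w                  ∎
    a✶b+s≡a✶b : a ✶ b + s ≡ a ✶ b
    a✶b+s≡a✶b = begin
      a ✶ b + s    ≡⟨ cong (_+ s) a✶b≡w+r ⟩
      (w + r) + s  ≡⟨ xy∙z≈xz∙y w r s ⟩
      (w + s) + r  ≡⟨ cong (_+ r) w+s≡w ⟩
      w + r        ≡⟨ a✶b≡w+r ⟨
      a ✶ b        ∎
    b≤a : b ≤ a
    b≤a = ≤-trans (x≤x∨y b c) b∨c≤a
    abe : BetM a b e
    abe = chain⇒BetM (x∧y≤x b c) b≤a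
    aeb : BetM a e b
    aeb = begin
      a ✶ e + e ✶ b    ≡⟨ cong₂ _+_ abe (✶-comm b e) ⟨
      (a ✶ b + s) + s  ≡⟨ cong (_+ s) a✶b+s≡a✶b ⟩
      a ✶ b + s        ≡⟨ a✶b+s≡a✶b ⟩
      a ✶ b            ∎

mainTheorem14 : ∀ {ℓ : Level} (A : ALMonoid ℓ) → let open ALMonoid A in
    ((Cond1 → Cond2) × (Cond2 → Cond1))
    × ((Cond1 → Cond3) × (Cond3 → Cond1))
    × ((Cond1 → Cond4) × (Cond4 → Cond1))
mainTheorem14 A =
  (Cond1⇒Cond2 , λ h → Cond3⇒Cond1 (Cond4⇒Cond3 (Cond2⇒Cond4 h))) ,
  ((λ h → Cond4⇒Cond3 (Cond2⇒Cond4 (Cond1⇒Cond2 h))) , Cond3⇒Cond1) ,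
  ((λ h → Cond2⇒Cond4 (Cond1⇒Cond2 h)) , λ h → Cond3⇒Cond1 (Cond4⇒Cond3 h))
  where open ALMonoidProperties A
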